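{- For every integer $n \geq 1$, $N(n) \geq \left\lfloor \frac{2n+1}{3} \right\rfloor$.
   Context: For a positive integer $n$, the triangle of size $n$ is the set of cells $T_n = \{(a,b) : a,b \in \{1,\dots,n\},\ a+b \geq n+1\}$ of an $n\times n$ grid, where $a$ indexes rows from top to bottom and $b$ indexes columns from left to right (so $T_n$ consists of the cells on or below the longest southwest-to-northeast diagonal of the square). A row is a set of cells of $T_n$ with fixed $a$, a column is a set with fixed $b$, and a standard diagonal (southwest-to-northeast) is a set of cells of $T_n$ with fixed $a+b$. $N(n)$ denotes the maximum number of dots that can be placed into cells of $T_n$ (at most one dot per cell) such that each row, each column and each standard diagonal contains at most one dot. -}

module Defs where

open import Data.Nat using (ℕ; _+_; _≤_)
open import Data.Product using (_×_; proj₁; proj₂)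
open import Data.List using (List; length)
open import Data.List.Relation.Unary.All using (All)
open import Data.List.Relation.Unary.AllPairs using (AllPairs)
open import Relation.Binary.PropositionalEquality using (_≢_)

-- A cell (a , b): a = row index (top to bottom), b = column index (left to right).
Cell : Set
Cell = ℕ × ℕ

row : Cell → ℕ
row = proj₁

col : Cell → ℕ
col = proj₂

diag : Cell → ℕ
diag c = row c + col c

InTriangle : ℕ → Cell → Set
InTriangle n c = (1 ≤ row c) × (row c ≤ n) × (1 ≤ col c) × (col c ≤ n) × (n + 1 ≤ row c + col c)

NonAttacking : Cell → Cell → Set
NonAttacking c d = (row c ≢ row d) × (col c ≢ col d) × (diag c ≢ diag d)

ValidPlacement : ℕ → List Cell → Set
ValidPlacement n ds = All (InTriangle n) ds × AllPairs NonAttacking ds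

-- Along a line of dots that moves one row down and two columns left per step, rows, columns and
-- diagonals all change, so such a line is non-attacking. In T_n with n = 2m + p + 2e + 1 and m ≤ p,
-- a line of m + e + 1 dots reaching the bottom row and the last column, together with a line of
-- m dots in rows above it, on columns of the other parity and on smaller diagonals,
-- gives 2m + e + 1 dots; choosing (m, p, e) by the residue of n mod 3 yields ⌊(2n+1)/3⌋.
module Submission where

open import Defs
open import Data.Nat using (ℕ; zero; suc; _+_; _*_; _/_; _≤_; _<_; s≤s; z≤n)
open import Data.Nat.Properties
open import Data.Nat.DivMod using (m<n*o⇒m/o<n; _divMod_; result)
open import Data.Nat.Tactic.RingSolver using (solve)
import Data.Fin as Fin
open import Data.Product using (Σ; ∃; ∃₂; _×_; _,_)
open import Data.List using (List; []; _∷_; _++_; length)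
open import Data.List.Properties using (length-++)
open import Data.List.Relation.Unary.All as All using (All)
open import Data.List.Relation.Unary.All.Properties using (++⁺)
open import Data.List.Relation.Unary.AllPairs as AllPairs using (AllPairs)
import Data.List.Relation.Unary.AllPairs.Properties as AllPairs
open import Relation.Binary.PropositionalEquality
open ≤-Reasoning

≤-offset : ∀ {m n} k → m + k ≡ n → m ≤ n
≤-offset k refl = m≤m+n _ k

line : ℕ → ℕ → ℕ → List Cell
line a c zero    = []
line a c (suc L) = (a , c + 2 * L) ∷ line (suc a) c L

OnLine : ℕ → ℕ → ℕ → Cell → Set
OnLine a c L x = ∃₂ λ i j → suc (i + j) ≡ L × x ≡ (a + i , c + 2 * j)

line-length : ∀ a c L → length (line a c L) ≡ L
line-length a c zero    = refl
line-length a c (suc L) = cong suc (line-length (suc a) c L)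

line-all : ∀ {P : Cell → Set} a c L → (∀ {x} → OnLine a c L x → P x) → All P (line a c L)
line-all a c zero    onLine⇒P = All.[]
line-all a c (suc L) onLine⇒P =
  onLine⇒P (0 , L , refl , cong (_, c + 2 * L) (sym (+-identityʳ a))) All.∷
  line-all (suc a) c L λ where
    (i , j , refl , refl) → onLine⇒P (suc i , j , refl , cong (_, c + 2 * j) (sym (+-suc a i)))

-- The end cells of the line lie in T_n, and so does its lowest diagonal a + c + L - 1.
FitsIn : ℕ → ℕ → ℕ → ℕ → Set
FitsIn n a c L = 1 ≤ a × a + L ≤ n + 1 × 1 ≤ c × c + 2 * L ≤ n + 2 × n + 2 ≤ a + c + L

onLine-inTriangle : ∀ {n a c L x} → FitsIn n a c L → OnLine a c L x → InTriangle n x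
onLine-inTriangle {n} {a} {c} (1≤a , bottom , 1≤c , right , lowest) (i , j , refl , refl) =
  ≤-trans 1≤a (m≤m+n a i) ,
  +-cancelʳ-≤ 1 (a + i) n (begin
    a + i + 1                 ≤⟨ ≤-offset j (solve (a ∷ i ∷ j ∷ [])) ⟩
    a + suc (i + j)           ≤⟨ bottom ⟩
    n + 1                     ∎) ,
  ≤-trans 1≤c (m≤m+n c (2 * j)) ,
  +-cancelʳ-≤ 2 (c + 2 * j) n (begin
    c + 2 * j + 2             ≤⟨ ≤-offset (2 * i) (solve (c ∷ i ∷ j ∷ [])) ⟩
    c + 2 * suc (i + j)       ≤⟨ right ⟩
    n + 2                     ∎) ,
  +-cancelʳ-≤ 1 (n + 1) (a + i + (c + 2 * j)) (begin
    n + 1 + 1                 ≡⟨ +-assoc n 1 1 ⟩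
    n + 2                     ≤⟨ lowest ⟩
    a + c + suc (i + j)       ≤⟨ ≤-offset j (solve (a ∷ c ∷ i ∷ j ∷ [])) ⟩
    a + i + (c + 2 * j) + 1   ∎)

line-inTriangle : ∀ {n a c L} → FitsIn n a c L → All (InTriangle n) (line a c L)
line-inTriangle {a = a} {c} {L} fits = line-all a c L (onLine-inTriangle fits)

onLine-nonAttacking-head : ∀ {a c L x} → OnLine (suc a) c L x → NonAttacking (a , c + 2 * L) x
onLine-nonAttacking-head {a} {c} (i , j , refl , refl) =
  <⇒≢ (s≤s (m≤m+n a i)) ,
  >⇒≢ (begin-strict
    c + 2 * j                        <⟨ ≤-offset (1 + 2 * i) (solve (c ∷ i ∷ j ∷ [])) ⟩
    c + 2 * suc (i + j)              ∎) ,
  >⇒≢ (begin-strict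
    suc a + i + (c + 2 * j)          <⟨ ≤-offset i (solve (a ∷ c ∷ i ∷ j ∷ [])) ⟩
    a + (c + 2 * suc (i + j))        ∎)

line-nonAttacking : ∀ a c L → AllPairs NonAttacking (line a c L)
line-nonAttacking a c zero    = AllPairs.[]
line-nonAttacking a c (suc L) =
  line-all (suc a) c L (onLine-nonAttacking-head {a} {c}) AllPairs.∷ line-nonAttacking (suc a) c L

-- Columns of the two lines differ in parity; the second line lies strictly above the first
-- and its highest diagonal a' + c' + 2L' - 2 is below the lowest diagonal a + c + L - 1 of the first.
onLines-nonAttacking : ∀ {a c L a' d L' x y} →
  a' + L' ≤ a → a' + (c + suc (2 * d)) + 2 * L' ≤ a + c + L →
  OnLine a c L x → OnLine a' (c + suc (2 * d)) L' y → NonAttacking x y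
onLines-nonAttacking {a} {c} {a' = a'} {d} above below (i , j , refl , refl) (i' , j' , refl , refl) =
  >⇒≢ (begin-strict
    a' + i'          <⟨ ≤-offset j' (solve (a' ∷ i' ∷ j' ∷ [])) ⟩
    a' + suc (i' + j') ≤⟨ above ⟩
    a                ≤⟨ m≤m+n a i ⟩
    a + i            ∎) ,
  (λ same-column → even≢odd j (d + j') (+-cancelˡ-≡ c _ _ (begin-equality
    c + 2 * j                  ≡⟨ same-column ⟩
    c + suc (2 * d) + 2 * j'   ≡⟨ solve (c ∷ d ∷ j' ∷ []) ⟩
    c + suc (2 * (d + j'))     ∎))) ,
  >⇒≢ (≤-pred (begin
    suc (suc (a' + i' + (c + suc (2 * d) + 2 * j')))
      ≤⟨ ≤-offset i' (solve (a' ∷ c ∷ d ∷ i' ∷ j' ∷ [])) ⟩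
    a' + (c + suc (2 * d)) + 2 * suc (i' + j')
      ≤⟨ below ⟩
    a + c + suc (i + j)
      ≤⟨ ≤-offset j (solve (a ∷ c ∷ i ∷ j ∷ [])) ⟩
    suc (a + i + (c + 2 * j))
      ∎))

lines-valid : ∀ {n a c L a' d L'} → let c' = c + suc (2 * d) in
  FitsIn n a c L → FitsIn n a' c' L' → a' + L' ≤ a → a' + c' + 2 * L' ≤ a + c + L →
  ValidPlacement n (line a c L ++ line a' c' L')
lines-valid {a = a} {c} {L} {a'} {d} {L'} fits fits' above below =
  ++⁺ (line-inTriangle fits) (line-inTriangle fits') ,
  AllPairs.++⁺ (line-nonAttacking a c L) (line-nonAttacking a' c' L')
    (line-all a c L λ onLine → line-all a' c' L' (onLines-nonAttacking {d = d} above below onLine))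
  where c' = c + suc (2 * d)

lowerLine-fits : ∀ m p e → FitsIn (2 * m + suc p + 2 * e) (m + suc p + e) (suc p) (suc (m + e))
lowerLine-fits m p e =
  ≤-offset (m + p + e) (solve (m ∷ p ∷ e ∷ [])) ,
  ≤-reflexive (solve (m ∷ p ∷ e ∷ [])) ,
  s≤s z≤n ,
  ≤-reflexive (solve (m ∷ p ∷ e ∷ [])) ,
  ≤-offset p (solve (m ∷ p ∷ e ∷ []))

upperLine-fits : ∀ {m p} e → m ≤ p → FitsIn (2 * m + suc p + 2 * e) (suc p) (suc p + suc (2 * e)) m
upperLine-fits {m} {p} e m≤p =
  s≤s z≤n ,
  ≤-offset (m + 2 * e + 1) (solve (m ∷ p ∷ e ∷ [])) ,
  s≤s z≤n ,
  ≤-offset 1 (solve (m ∷ p ∷ e ∷ [])) ,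
  (begin
    2 * m + suc p + 2 * e + 2         ≡⟨ solve (m ∷ p ∷ e ∷ []) ⟩
    m + (m + p + 2 * e + 3)           ≤⟨ +-monoˡ-≤ (m + p + 2 * e + 3) m≤p ⟩
    p + (m + p + 2 * e + 3)           ≡⟨ solve (m ∷ p ∷ e ∷ []) ⟩
    suc p + (suc p + suc (2 * e)) + m ∎)

twoLines-placement : ∀ {n} m p e → m ≤ p → n ≡ 2 * m + suc p + 2 * e →
  ∃ λ ds → ValidPlacement n ds × length ds ≡ 2 * m + e + 1
twoLines-placement m p e m≤p refl =
  lower ++ upper ,
  lines-valid {d = e} (lowerLine-fits m p e) (upperLine-fits e m≤p)
    (≤-offset e (solve (m ∷ p ∷ e ∷ []))) (≤-reflexive (solve (m ∷ p ∷ e ∷ []))) ,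
  (begin-equality
    length (lower ++ upper)           ≡⟨ length-++ lower ⟩
    length lower + length upper       ≡⟨ cong₂ _+_ (line-length (m + suc p + e) (suc p) (suc (m + e)))
                                                   (line-length (suc p) (suc p + suc (2 * e)) m) ⟩
    suc (m + e) + m                   ≡⟨ solve (m ∷ e ∷ []) ⟩
    2 * m + e + 1                     ∎)
  where
  lower upper : List Cell
  lower = line (m + suc p + e) (suc p) (suc (m + e))
  upper = line (suc p) (suc p + suc (2 * e)) m

attains-bound : ∀ {n k} → (∃ λ ds → ValidPlacement n ds × length ds ≡ k) →
  2 * n + 1 < suc k * 3 →
  Σ (List Cell) λ ds → ValidPlacement n ds × (2 * n + 1) / 3 ≤ length ds
attains-bound (ds , valid , refl) bound = ds , valid , ≤-pred (m<n*o⇒m/o<n bound)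

theorem2 : (n : ℕ) → 1 ≤ n →
    Σ (List Cell) λ ds → ValidPlacement n ds × (2 * n + 1) / 3 ≤ length ds
theorem2 (suc k) _ with k divMod 3
... | result q Fin.zero refl =
  attains-bound (twoLines-placement q q 0 ≤-refl n≡) bound
  where
  n≡ : suc (q * 3) ≡ 2 * q + suc q + 2 * 0
  n≡ = solve (q ∷ [])
  bound : 2 * suc (q * 3) + 1 < suc (2 * q + 0 + 1) * 3
  bound = ≤-offset 2 (solve (q ∷ []))
... | result q (Fin.suc Fin.zero) refl =
  attains-bound (twoLines-placement q (suc q) 0 (n≤1+n q) n≡) bound
  where
  n≡ : suc (suc (q * 3)) ≡ 2 * q + suc (suc q) + 2 * 0
  n≡ = solve (q ∷ [])
  bound : 2 * suc (suc (q * 3)) + 1 < suc (2 * q + 0 + 1) * 3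
  bound = ≤-offset 0 (solve (q ∷ []))
... | result q (Fin.suc (Fin.suc Fin.zero)) refl =
  attains-bound (twoLines-placement q q 1 ≤-refl n≡) bound
  where
  n≡ : suc (suc (suc (q * 3))) ≡ 2 * q + suc q + 2 * 1
  n≡ = solve (q ∷ [])
  bound : 2 * suc (suc (suc (q * 3))) + 1 < suc (2 * q + 1 + 1) * 3
  bound = ≤-offset 1 (solve (q ∷ []))
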